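{- Let $m,r,s,\alpha$ be integers with $m\geq r\geq 0$, $s\geq 0$ and $\alpha\geq 1$. Then for $|x|<1$, $$\sum_{n=r}^{\infty}\Bigl(\sum_{k=0}^{n}\binom{k}{r}\binom{n+s-k}{s}r!\,k^{m-r}H^{(\alpha)}_k\Bigr)x^{n}=\sum_{n=r}^{\infty}\Bigl(\sum_{0\leq k_1\leq\cdots\leq k_{s+1}\leq n}\binom{k_1}{r}r!\,k_1^{m-r}H^{(\alpha)}_{k_1}\Bigr)x^{n}=\frac{1}{(1-x)^{\alpha+s+1}}\Bigl\{{}_rF^{h}_{m,\alpha}\Bigl(\frac{x}{1-x}\Bigr)-{}_rF_{m,\alpha}\Bigl(\frac{x}{1-x}\Bigr)\ln(1-x)\Bigr\}.$$
   Context: $H_n=\sum_{j=1}^{n}\frac1j$, $H_0=0$; hyperharmonic numbers: $H^{(1)}_n=H_n$, $H^{(\alpha)}_n=\sum_{k=1}^{n}H^{(\alpha-1)}_k$ (so $H^{(\alpha)}_0=0$); $0^0=1$. The $r$-Stirling numbers of the second kind $\left\{ {n \atop k}\right\}_r$ count partitions of $\{1,\dots,n\}$ into $k$ nonempty blocks with $1,\dots,r$ in distinct blocks. Hyperharmonic $r$-geometric polynomials: ${}_rF^h_{n,\alpha}(y)=\sum_{k=0}^{n}\left\{ {n \atop k}\right\}_r k!\,H^{(\alpha)}_k y^k$. General $r$-geometric polynomials: ${}_rF_{n,\alpha}(y)=\frac{1}{\Gamma(\alpha)}\sum_{k=0}^{n}\left\{ {n \atop k}\right\}_r\Gamma(k+\alpha)y^k$.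 -}

module Defs where

open import Data.Nat as ℕ using (ℕ; zero; suc; _∸_; _<ᵇ_; _≡ᵇ_; _!)
open import Data.Nat.Combinatorics using (_C_)
open import Data.Integer using (+_)
open import Data.Rational using (ℚ; 0ℚ; 1ℚ; _+_; _*_; _-_; -_; _/_)
open import Data.Bool using (if_then_else_)

ι : ℕ → ℚ
ι n = + n / 1

sumTo : ℕ → (ℕ → ℚ) → ℚ
sumTo zero f = f 0
sumTo (suc n) f = sumTo n f + f (suc n)

harmonic : ℕ → ℚ
harmonic zero = 0ℚ
harmonic (suc n) = harmonic n + (+ 1 / suc n)

-- hyperharmonic numbers H^{(α)}_n for α ≥ 1.
-- (The value at α = 0 is never used: the theorem assumes α ≥ 1.)
hyperharmonic : ℕ → ℕ → ℚ
hyperharmonic zero n = 0ℚ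
hyperharmonic (suc zero) n = harmonic n
hyperharmonic (suc (suc a)) zero = 0ℚ
hyperharmonic (suc (suc a)) (suc n) =
  hyperharmonic (suc (suc a)) n + hyperharmonic (suc a) (suc n)

-- r-Stirling numbers of the second kind, via the standard recurrence (Broder):
--   {n k}_r = 0 for n < r,  {r k}_r = [k = r],
--   {n+1 k}_r = k {n k}_r + {n k-1}_r  for n ≥ r.
-- rStirAux r d k = {r+d k}_r
rStirAux : ℕ → ℕ → ℕ → ℕ
rStirAux r zero k = if k ≡ᵇ r then 1 else 0
rStirAux r (suc d) zero = 0
rStirAux r (suc d) (suc k) = suc k ℕ.* rStirAux r d (suc k) ℕ.+ rStirAux r d k

rStirling : ℕ → ℕ → ℕ → ℕ
rStirling r n k = if n <ᵇ r then 0 else rStirAux r (n ∸ r) k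

-- rising factorial α(α+1)…(α+k-1) = Γ(k+α)/Γ(α)
rising : ℕ → ℕ → ℕ
rising a zero = 1
rising a (suc k) = rising a k ℕ.* (a ℕ.+ k)

PS : Set
PS = ℕ → ℚ

_⊕_ : PS → PS → PS
(f ⊕ g) n = f n + g n

_⊖_ : PS → PS → PS
(f ⊖ g) n = f n - g n

scaleS : ℚ → PS → PS
scaleS c f n = c * f n

_⊛_ : PS → PS → PS
(f ⊛ g) n = sumTo n (λ i → f i * g (n ∸ i))

oneS : PS
oneS zero = 1ℚ
oneS (suc n) = 0ℚ

xS : PS
xS (suc zero) = 1ℚ
xS _ = 0ℚ

powS : PS → ℕ → PS
powS f zero = oneS
powS f (suc k) = powS f k ⊛ f

invOneMinusX : PS
invOneMinusX n = 1ℚ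

logOneMinusX : PS
logOneMinusX zero = 0ℚ
logOneMinusX (suc n) = - (+ 1 / suc n)

yS : PS
yS = xS ⊛ invOneMinusX

polyAtY : ℕ → (ℕ → ℚ) → PS
polyAtY m c n = sumTo m (λ k → c k * powS yS k n)

rFhCoeff : ℕ → ℕ → ℕ → ℕ → ℚ
rFhCoeff r n a k = ι (rStirling r n k ℕ.* (k !)) * hyperharmonic a k

-- general r-geometric polynomial  _rF_{n,α}(y) = (1/Γ(α)) Σ_k {n k}_r Γ(k+α) y^k
rFCoeff : ℕ → ℕ → ℕ → ℕ → ℚ
rFCoeff r n a k = ι (rStirling r n k ℕ.* rising a k)

term : ℕ → ℕ → ℕ → ℕ → ℚ
term m r a k = ι ((k C r) ℕ.* (r !) ℕ.* (k ℕ.^ (m ∸ r))) * hyperharmonic a k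

lhsS : ℕ → ℕ → ℕ → ℕ → PS
lhsS m r s a n =
  if n <ᵇ r then 0ℚ
  else sumTo n (λ k → ι ((n ℕ.+ s ∸ k) C s) * term m r a k)

-- chainSum s n f = Σ_{0 ≤ k₁ ≤ k₂ ≤ … ≤ k_{s+1} ≤ n} f k₁
chainSum : ℕ → ℕ → (ℕ → ℚ) → ℚ
chainSum zero n f = sumTo n f
chainSum (suc s) n f = sumTo n (λ k → chainSum s k f)

midS : ℕ → ℕ → ℕ → ℕ → PS
midS m r s a n = if n <ᵇ r then 0ℚ else chainSum s n (term m r a)

rhsS : ℕ → ℕ → ℕ → ℕ → PS
rhsS m r s a =
  powS invOneMinusX (a ℕ.+ s ℕ.+ 1)
  ⊛ (polyAtY m (rFhCoeff r m a) ⊖ (polyAtY m (rFCoeff r m a) ⊛ logOneMinusX))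

module Submission where

-- The argument is driven by the Euler operator θ = x d/dx, (θ f)_n = n f_n,
-- a derivation of ⊛.  A family (U_k) of series is a θ-ladder if
-- θ U_k = k U_k + U_{k+1}.  Two general facts about θ-ladders are used:
--   * a θ-ladder is determined by its bottom rung U_0;
--   * its Stirling transform W_m = Σ_k {m k}_r U_k satisfies W_r = U_r and,
--     by the r-Stirling recurrence, W_{m+1} = θ W_m.
-- For α ≥ 1 there are two θ-ladders with bottom rung Σ_n H^{(α)}_n x^n:
--   E_k = Σ_n n(n-1)…(n-k+1) H^{(α)}_n x^n   and
--   B_k = (1-x)^{-α} y^k (k! H^{(α)}_k - α^{(k)} ln(1-x)),  y = x/(1-x),
-- the latter because k! H^{(α)}_k obeys a first-order recurrence derived
-- from the closed form H^{(α)}_k = C(k+α-1, α-1)(H_{k+α-1} - H_{α-1}).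
-- Hence E = B.  The summand of the theorem is θ^{m-r} E_r, the Stirling
-- transform of E at m, and (1-x)^{-α} times the bracket of the theorem is
-- the Stirling transform of B at m.  Finally both inner sums of the
-- theorem are Cauchy products with (1-x)^{-(s+1)} = Σ_n C(n+s,s) x^n.

open import Defs
open import Data.Bool using (if_then_else_)
import Data.Integer as ℤ
import Data.Integer.Properties as ℤP
open import Data.Nat as ℕ using (ℕ; zero; suc; _≤_; _<_; z≤n; s≤s; _∸_; _!; _<ᵇ_)
import Data.Nat.Properties as ℕP
open import Data.Nat.Combinatorics using (_C_; nCk+nC[k+1]≡[n+1]C[k+1]; nCn≡1; k>n⇒nCk≡0)
open import Data.Nat.Tactic.RingSolver using (solve-∀)
import Data.Nat.Coprimality as Coprime
open import Data.Product using (_×_; _,_)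
open import Data.Rational using (ℚ; 0ℚ; 1ℚ; _+_; _*_; _-_; -_; _/_; mkℚ)
import Data.Rational.Properties as ℚP
open import Data.Rational.Solver using (module +-*-Solver)
open import Data.Sum using (inj₁; inj₂)
open import Relation.Nullary.Decidable using (yes; no; dec-true; dec-false)
open import Relation.Binary.PropositionalEquality
open +-*-Solver
open ≡-Reasoning

ι≡mkℚ : ∀ n → ι n ≡ mkℚ (ℤ.+ n) 0 (Coprime.sym (Coprime.1-coprimeTo n))
ι≡mkℚ n = ℚP.↥p/↧p≡p (mkℚ (ℤ.+ n) 0 (Coprime.sym (Coprime.1-coprimeTo n)))

ι-+ : ∀ m n → ι (m ℕ.+ n) ≡ ι m + ι n
ι-+ m n = trans (ℚP./-cong (cong₂ ℤ._+_ (sym (ℤP.*-identityʳ (ℤ.+ m))) (sym (ℤP.*-identityʳ (ℤ.+ n)))) refl)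
               (sym (cong₂ _+_ (ι≡mkℚ m) (ι≡mkℚ n)))

ι-* : ∀ m n → ι (m ℕ.* n) ≡ ι m * ι n
ι-* m n = trans (ℚP./-cong {p₁ = ℤ.+ (m ℕ.* n)} {q₁ = 1} (ℤP.pos-* m n) refl)
               (sym (cong₂ _*_ (ι≡mkℚ m) (ι≡mkℚ n)))

ι-suc : ∀ n → ι (suc n) ≡ 1ℚ + ι n
ι-suc n = ι-+ 1 n

ι-suc-* : ∀ a v → ι a * v + v ≡ ι (suc a) * v
ι-suc-* a v = begin
  ι a * v + v    ≡⟨ solve 2 (λ x v → x :* v :+ v := (con 1ℚ :+ x) :* v) refl (ι a) v ⟩
  (1ℚ + ι a) * v ≡⟨ cong (_* v) (sym (ι-suc a)) ⟩
  ι (suc a) * v  ∎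

ι-inverse : ∀ n → ι (suc n) * (ℤ.+ 1 / suc n) ≡ 1ℚ
ι-inverse n = trans (cong₂ _*_ (ι≡mkℚ (suc n)) (ℚP.normalize-coprime {1} {n} (Coprime.1-coprimeTo (suc n))))
                    (ℚP.*-inverseʳ (mkℚ (ℤ.+ suc n) 0 (Coprime.sym (Coprime.1-coprimeTo (suc n)))))

Σ-cong : ∀ n {f g : ℕ → ℚ} → (∀ k → k ≤ n → f k ≡ g k) → sumTo n f ≡ sumTo n g
Σ-cong zero eq = eq 0 z≤n
Σ-cong (suc n) eq = cong₂ _+_ (Σ-cong n (λ k k≤n → eq k (ℕP.m≤n⇒m≤1+n k≤n))) (eq (suc n) ℕP.≤-refl)

Σ-ext : ∀ n {f g : ℕ → ℚ} → (∀ k → f k ≡ g k) → sumTo n f ≡ sumTo n g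
Σ-ext n eq = Σ-cong n (λ k _ → eq k)

Σ-vanish : ∀ n (f : ℕ → ℚ) → (∀ k → k ≤ n → f k ≡ 0ℚ) → sumTo n f ≡ 0ℚ
Σ-vanish zero f eq = eq 0 z≤n
Σ-vanish (suc n) f eq =
  cong₂ _+_ (Σ-vanish n f (λ k k≤n → eq k (ℕP.m≤n⇒m≤1+n k≤n))) (eq (suc n) ℕP.≤-refl)

Σ-+ : ∀ n (f g : ℕ → ℚ) → sumTo n (λ k → f k + g k) ≡ sumTo n f + sumTo n g
Σ-+ zero f g = refl
Σ-+ (suc n) f g = begin
  sumTo n (λ k → f k + g k) + (f (suc n) + g (suc n))
    ≡⟨ cong (_+ (f (suc n) + g (suc n))) (Σ-+ n f g) ⟩
  (sumTo n f + sumTo n g) + (f (suc n) + g (suc n))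
    ≡⟨ solve 4 (λ a b c d → (a :+ b) :+ (c :+ d) := (a :+ c) :+ (b :+ d)) refl
         (sumTo n f) (sumTo n g) (f (suc n)) (g (suc n)) ⟩
  (sumTo n f + f (suc n)) + (sumTo n g + g (suc n)) ∎

Σ-*ˡ : ∀ n c (f : ℕ → ℚ) → sumTo n (λ k → c * f k) ≡ c * sumTo n f
Σ-*ˡ zero c f = refl
Σ-*ˡ (suc n) c f =
  trans (cong (_+ (c * f (suc n))) (Σ-*ˡ n c f)) (sym (ℚP.*-distribˡ-+ c (sumTo n f) (f (suc n))))

Σ-*ʳ : ∀ n c (f : ℕ → ℚ) → sumTo n (λ k → f k * c) ≡ sumTo n f * c
Σ-*ʳ n c f = trans (Σ-ext n (λ k → ℚP.*-comm (f k) c)) (trans (Σ-*ˡ n c f) (ℚP.*-comm c (sumTo n f)))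

Σ-neg : ∀ n (f : ℕ → ℚ) → sumTo n (λ k → - f k) ≡ - sumTo n f
Σ-neg zero f = refl
Σ-neg (suc n) f =
  trans (cong (_+ (- f (suc n))) (Σ-neg n f)) (sym (ℚP.neg-distrib-+ (sumTo n f) (f (suc n))))

Σ-- : ∀ n (f g : ℕ → ℚ) → sumTo n (λ k → f k - g k) ≡ sumTo n f - sumTo n g
Σ-- n f g = trans (Σ-+ n f (λ k → - g k)) (cong (sumTo n f +_) (Σ-neg n g))

Σ-head : ∀ n (f : ℕ → ℚ) → sumTo (suc n) f ≡ f 0 + sumTo n (λ k → f (suc k))
Σ-head zero f = refl
Σ-head (suc n) f = begin
  sumTo (suc n) f + f (suc (suc n))
    ≡⟨ cong (_+ f (suc (suc n))) (Σ-head n f) ⟩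
  (f 0 + sumTo n (λ k → f (suc k))) + f (suc (suc n))
    ≡⟨ ℚP.+-assoc (f 0) _ _ ⟩
  f 0 + (sumTo n (λ k → f (suc k)) + f (suc (suc n))) ∎

Σ-reverse : ∀ n (f : ℕ → ℚ) → sumTo n f ≡ sumTo n (λ k → f (n ∸ k))
Σ-reverse zero f = refl
Σ-reverse (suc n) f = begin
  sumTo n f + f (suc n)                  ≡⟨ ℚP.+-comm (sumTo n f) (f (suc n)) ⟩
  f (suc n) + sumTo n f                  ≡⟨ cong (f (suc n) +_) (Σ-reverse n f) ⟩
  f (suc n) + sumTo n (λ k → f (n ∸ k))  ≡⟨ sym (Σ-head n (λ k → f (suc n ∸ k))) ⟩
  sumTo (suc n) (λ k → f (suc n ∸ k))    ∎

Σ-swap : ∀ n m (F : ℕ → ℕ → ℚ) →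
  sumTo n (λ i → sumTo m (λ j → F i j)) ≡ sumTo m (λ j → sumTo n (λ i → F i j))
Σ-swap zero m F = refl
Σ-swap (suc n) m F = begin
  sumTo n (λ i → sumTo m (λ j → F i j)) + sumTo m (λ j → F (suc n) j)
    ≡⟨ cong (_+ sumTo m (λ j → F (suc n) j)) (Σ-swap n m F) ⟩
  sumTo m (λ j → sumTo n (λ i → F i j)) + sumTo m (λ j → F (suc n) j)
    ≡⟨ sym (Σ-+ m _ _) ⟩
  sumTo m (λ j → sumTo (suc n) (λ i → F i j)) ∎

Σ-triangle : ∀ n (F : ℕ → ℕ → ℚ) →
  sumTo n (λ t → sumTo t (λ i → F i t)) ≡ sumTo n (λ i → sumTo (n ∸ i) (λ u → F i (i ℕ.+ u)))
Σ-triangle zero F = refl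
Σ-triangle (suc n) F = begin
  sumTo n (λ t → sumTo t (λ i → F i t)) + (sumTo n (λ i → F i (suc n)) + F (suc n) (suc n))
    ≡⟨ cong (_+ (sumTo n (λ i → F i (suc n)) + F (suc n) (suc n))) (Σ-triangle n F) ⟩
  rows n + (sumTo n (λ i → F i (suc n)) + F (suc n) (suc n))
    ≡⟨ sym (ℚP.+-assoc (rows n) _ _) ⟩
  (rows n + sumTo n (λ i → F i (suc n))) + F (suc n) (suc n)
    ≡⟨ cong₂ _+_ (sym (Σ-+ n _ _)) (cong (F (suc n)) (sym (ℕP.+-identityʳ (suc n)))) ⟩
  sumTo n (λ i → row n i + F i (suc n)) + F (suc n) (suc n ℕ.+ 0)
    ≡⟨ cong₂ _+_ (Σ-cong n extend-row) (cong (λ z → sumTo z (λ u → F (suc n) (suc n ℕ.+ u))) (sym (ℕP.n∸n≡0 (suc n)))) ⟩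
  rows (suc n) ∎
  where
  row : ℕ → ℕ → ℚ
  row n i = sumTo (n ∸ i) (λ u → F i (i ℕ.+ u))
  rows : ℕ → ℚ
  rows n = sumTo n (row n)
  extend-row : ∀ i → i ≤ n → row n i + F i (suc n) ≡ row (suc n) i
  extend-row i i≤n = begin
    row n i + F i (suc n)
      ≡⟨ cong (λ z → row n i + F i z) (sym (trans (ℕP.+-suc i (n ∸ i)) (cong suc (ℕP.m+[n∸m]≡n i≤n)))) ⟩
    sumTo (suc (n ∸ i)) (λ u → F i (i ℕ.+ u))
      ≡⟨ cong (λ z → sumTo z (λ u → F i (i ℕ.+ u))) (sym (ℕP.+-∸-assoc 1 i≤n)) ⟩
    row (suc n) i ∎

Σ-last : ∀ n (f : ℕ → ℚ) → (∀ k → k < n → f k ≡ 0ℚ) → sumTo n f ≡ f n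
Σ-last zero f _ = refl
Σ-last (suc n) f below =
  trans (cong (_+ f (suc n)) (Σ-vanish n f (λ k k≤n → below k (s≤s k≤n)))) (ℚP.+-identityˡ (f (suc n)))

Σ-shift : ∀ n (h : ℕ → ℚ) → h 0 ≡ 0ℚ → h (suc n) ≡ 0ℚ → sumTo n (λ k → h (suc k)) ≡ sumTo n h
Σ-shift n h h0≡0 h[n+1]≡0 = begin
  sumTo n (λ k → h (suc k))        ≡⟨ sym (ℚP.+-identityˡ _) ⟩
  0ℚ + sumTo n (λ k → h (suc k))   ≡⟨ cong (_+ sumTo n (λ k → h (suc k))) (sym h0≡0) ⟩
  h 0 + sumTo n (λ k → h (suc k))  ≡⟨ sym (Σ-head n h) ⟩
  sumTo n h + h (suc n)            ≡⟨ cong (sumTo n h +_) h[n+1]≡0 ⟩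
  sumTo n h + 0ℚ                   ≡⟨ ℚP.+-identityʳ _ ⟩
  sumTo n h                        ∎

infix 4 _≈_
_≈_ : PS → PS → Set
f ≈ g = ∀ n → f n ≡ g n

≈-sym : ∀ {f g} → f ≈ g → g ≈ f
≈-sym e n = sym (e n)

≈-trans : ∀ {f g h} → f ≈ g → g ≈ h → f ≈ h
≈-trans e e′ n = trans (e n) (e′ n)

negS : PS → PS
negS f n = - f n

sumS : ℕ → (ℕ → PS) → PS
sumS m F n = sumTo m (λ k → F k n)

⊛-congˡ : ∀ {f f′} g → f ≈ f′ → (f ⊛ g) ≈ (f′ ⊛ g)
⊛-congˡ g e n = Σ-ext n (λ i → cong (_* g (n ∸ i)) (e i))

⊛-congʳ : ∀ f {g g′} → g ≈ g′ → (f ⊛ g) ≈ (f ⊛ g′)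
⊛-congʳ f e n = Σ-ext n (λ i → cong (f i *_) (e (n ∸ i)))

⊛-comm : ∀ f g → (f ⊛ g) ≈ (g ⊛ f)
⊛-comm f g n = begin
  sumTo n (λ i → f i * g (n ∸ i))
    ≡⟨ Σ-reverse n (λ i → f i * g (n ∸ i)) ⟩
  sumTo n (λ k → f (n ∸ k) * g (n ∸ (n ∸ k)))
    ≡⟨ Σ-cong n (λ k k≤n → trans (cong (λ z → f (n ∸ k) * g z) (ℕP.m∸[m∸n]≡n k≤n)) (ℚP.*-comm (f (n ∸ k)) (g k))) ⟩
  sumTo n (λ k → g k * f (n ∸ k)) ∎

⊛-assoc : ∀ f g h → ((f ⊛ g) ⊛ h) ≈ (f ⊛ (g ⊛ h))
⊛-assoc f g h n = begin
  sumTo n (λ t → sumTo t (λ i → f i * g (t ∸ i)) * h (n ∸ t))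
    ≡⟨ Σ-ext n (λ t → sym (Σ-*ʳ t (h (n ∸ t)) (λ i → f i * g (t ∸ i)))) ⟩
  sumTo n (λ t → sumTo t (λ i → f i * g (t ∸ i) * h (n ∸ t)))
    ≡⟨ Σ-triangle n (λ i t → f i * g (t ∸ i) * h (n ∸ t)) ⟩
  sumTo n (λ i → sumTo (n ∸ i) (λ u → f i * g (i ℕ.+ u ∸ i) * h (n ∸ (i ℕ.+ u))))
    ≡⟨ Σ-ext n (λ i → Σ-ext (n ∸ i) (λ u → reindex i u)) ⟩
  sumTo n (λ i → sumTo (n ∸ i) (λ u → f i * (g u * h (n ∸ i ∸ u))))
    ≡⟨ Σ-ext n (λ i → Σ-*ˡ (n ∸ i) (f i) (λ u → g u * h (n ∸ i ∸ u))) ⟩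
  sumTo n (λ i → f i * sumTo (n ∸ i) (λ u → g u * h (n ∸ i ∸ u))) ∎
  where
  reindex : ∀ i u → f i * g (i ℕ.+ u ∸ i) * h (n ∸ (i ℕ.+ u)) ≡ f i * (g u * h (n ∸ i ∸ u))
  reindex i u = trans (cong₂ (λ p q → f i * g p * h q) (ℕP.m+n∸m≡n i u) (sym (ℕP.∸-+-assoc n i u)))
                      (ℚP.*-assoc (f i) (g u) (h (n ∸ i ∸ u)))

⊛-swapʳ : ∀ f g h → ((f ⊛ g) ⊛ h) ≈ ((f ⊛ h) ⊛ g)
⊛-swapʳ f g h =
  ≈-trans (⊛-assoc f g h) (≈-trans (⊛-congʳ f (⊛-comm g h)) (≈-sym (⊛-assoc f h g)))

⊛-identityˡ : ∀ f → (oneS ⊛ f) ≈ f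
⊛-identityˡ f zero = ℚP.*-identityˡ (f 0)
⊛-identityˡ f (suc n) = begin
  sumTo (suc n) (λ i → oneS i * f (suc n ∸ i))
    ≡⟨ Σ-head n (λ i → oneS i * f (suc n ∸ i)) ⟩
  1ℚ * f (suc n) + sumTo n (λ k → 0ℚ * f (n ∸ k))
    ≡⟨ cong₂ _+_ (ℚP.*-identityˡ (f (suc n))) (Σ-vanish n _ (λ k _ → ℚP.*-zeroˡ (f (n ∸ k)))) ⟩
  f (suc n) + 0ℚ
    ≡⟨ ℚP.+-identityʳ (f (suc n)) ⟩
  f (suc n) ∎

⊛-identityʳ : ∀ f → (f ⊛ oneS) ≈ f
⊛-identityʳ f = ≈-trans (⊛-comm f oneS) (⊛-identityˡ f)

⊛-distribˡ-⊕ : ∀ f g h → (f ⊛ (g ⊕ h)) ≈ ((f ⊛ g) ⊕ (f ⊛ h))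
⊛-distribˡ-⊕ f g h n =
  trans (Σ-ext n (λ i → ℚP.*-distribˡ-+ (f i) (g (n ∸ i)) (h (n ∸ i))))
        (Σ-+ n (λ i → f i * g (n ∸ i)) (λ i → f i * h (n ∸ i)))

⊛-distribʳ-⊕ : ∀ f g h → ((g ⊕ h) ⊛ f) ≈ ((g ⊛ f) ⊕ (h ⊛ f))
⊛-distribʳ-⊕ f g h n =
  trans (Σ-ext n (λ i → ℚP.*-distribʳ-+ (f (n ∸ i)) (g i) (h i)))
        (Σ-+ n (λ i → g i * f (n ∸ i)) (λ i → h i * f (n ∸ i)))

⊛-distribˡ-⊖ : ∀ f g h → (f ⊛ (g ⊖ h)) ≈ ((f ⊛ g) ⊖ (f ⊛ h))
⊛-distribˡ-⊖ f g h n =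
  trans (Σ-ext n (λ i → solve 3 (λ a b c → a :* (b :- c) := a :* b :- a :* c) refl (f i) (g (n ∸ i)) (h (n ∸ i))))
        (Σ-- n (λ i → f i * g (n ∸ i)) (λ i → f i * h (n ∸ i)))

⊛-negʳ : ∀ f g → (f ⊛ negS g) ≈ negS (f ⊛ g)
⊛-negʳ f g n =
  trans (Σ-ext n (λ i → sym (ℚP.neg-distribʳ-* (f i) (g (n ∸ i))))) (Σ-neg n (λ i → f i * g (n ∸ i)))

⊛-scaleˡ : ∀ c f g → (scaleS c f ⊛ g) ≈ scaleS c (f ⊛ g)
⊛-scaleˡ c f g n =
  trans (Σ-ext n (λ i → ℚP.*-assoc c (f i) (g (n ∸ i)))) (Σ-*ˡ n c (λ i → f i * g (n ∸ i)))

⊛-scaleʳ : ∀ c f g → (f ⊛ scaleS c g) ≈ scaleS c (f ⊛ g)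
⊛-scaleʳ c f g n =
  trans (Σ-ext n (λ i → solve 3 (λ a b c → a :* (c :* b) := c :* (a :* b)) refl (f i) (g (n ∸ i)) c))
        (Σ-*ˡ n c (λ i → f i * g (n ∸ i)))

⊛-sumSʳ : ∀ m f F → (f ⊛ sumS m F) ≈ sumS m (λ k → f ⊛ F k)
⊛-sumSʳ m f F n =
  trans (Σ-ext n (λ i → sym (Σ-*ˡ m (f i) (λ k → F k (n ∸ i))))) (Σ-swap n m (λ i k → f i * F k (n ∸ i)))

⊛-sumSˡ : ∀ m f F → (sumS m F ⊛ f) ≈ sumS m (λ k → F k ⊛ f)
⊛-sumSˡ m f F =
  ≈-trans (⊛-comm (sumS m F) f) (≈-trans (⊛-sumSʳ m f F) (λ n → Σ-ext m (λ k → ⊛-comm f (F k) n)))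

powS-+ : ∀ f b a → powS f (b ℕ.+ a) ≈ (powS f a ⊛ powS f b)
powS-+ f zero a = ≈-sym (⊛-identityʳ (powS f a))
powS-+ f (suc b) a = ≈-trans (⊛-congˡ f (powS-+ f b a)) (⊛-assoc (powS f a) (powS f b) f)

partialSums : ∀ g n → (invOneMinusX ⊛ g) n ≡ sumTo n g
partialSums g n = trans (Σ-ext n (λ i → ℚP.*-identityˡ (g (n ∸ i)))) (sym (Σ-reverse n g))

θ : PS → PS
θ f n = ι n * f n

θ-Leibniz : ∀ f g → θ (f ⊛ g) ≈ ((θ f ⊛ g) ⊕ (f ⊛ θ g))
θ-Leibniz f g n = begin
  ι n * sumTo n (λ i → f i * g (n ∸ i))
    ≡⟨ sym (Σ-*ˡ n (ι n) (λ i → f i * g (n ∸ i))) ⟩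
  sumTo n (λ i → ι n * (f i * g (n ∸ i)))
    ≡⟨ Σ-cong n split ⟩
  sumTo n (λ i → ι i * f i * g (n ∸ i) + f i * (ι (n ∸ i) * g (n ∸ i)))
    ≡⟨ Σ-+ n (λ i → ι i * f i * g (n ∸ i)) (λ i → f i * (ι (n ∸ i) * g (n ∸ i))) ⟩
  ((θ f ⊛ g) ⊕ (f ⊛ θ g)) n ∎
  where
  -- n = i + (n - i)
  split : ∀ i → i ≤ n → ι n * (f i * g (n ∸ i)) ≡ ι i * f i * g (n ∸ i) + f i * (ι (n ∸ i) * g (n ∸ i))
  split i i≤n = begin
    ι n * (f i * g (n ∸ i))
      ≡⟨ cong (λ z → ι z * (f i * g (n ∸ i))) (sym (ℕP.m+[n∸m]≡n i≤n)) ⟩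
    ι (i ℕ.+ (n ∸ i)) * (f i * g (n ∸ i))
      ≡⟨ cong (_* (f i * g (n ∸ i))) (ι-+ i (n ∸ i)) ⟩
    (ι i + ι (n ∸ i)) * (f i * g (n ∸ i))
      ≡⟨ solve 4 (λ a b x y → (a :+ b) :* (x :* y) := a :* x :* y :+ x :* (b :* y)) refl
           (ι i) (ι (n ∸ i)) (f i) (g (n ∸ i)) ⟩
    ι i * f i * g (n ∸ i) + f i * (ι (n ∸ i) * g (n ∸ i)) ∎

inv : PS
inv = invOneMinusX

L : PS
L = logOneMinusX

y-suc : ∀ n → yS (suc n) ≡ 1ℚ
y-suc zero = refl
y-suc (suc n) = begin
  yS (suc (suc n))
    ≡⟨ Σ-head (suc n) (λ i → xS i * inv (suc (suc n) ∸ i)) ⟩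
  0ℚ * 1ℚ + sumTo (suc n) (λ k → xS (suc k) * 1ℚ)
    ≡⟨ cong (0ℚ * 1ℚ +_) (Σ-head n (λ k → xS (suc k) * 1ℚ)) ⟩
  0ℚ * 1ℚ + (1ℚ * 1ℚ + sumTo n (λ k → 0ℚ * 1ℚ))
    ≡⟨ cong (λ z → 0ℚ * 1ℚ + (1ℚ * 1ℚ + z)) (Σ-vanish n _ (λ _ _ → refl)) ⟩
  1ℚ ∎

inv≈one⊕y : inv ≈ (oneS ⊕ yS)
inv≈one⊕y zero = refl
inv≈one⊕y (suc n) = sym (trans (cong (0ℚ +_) (y-suc n)) (ℚP.+-identityˡ 1ℚ))

y⊛inv-coeff : ∀ n → (yS ⊛ inv) n ≡ ι n
y⊛inv-coeff n = trans (Σ-ext n (λ i → ℚP.*-identityʳ (yS i))) (partial n)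
  where
  partial : ∀ n → sumTo n yS ≡ ι n
  partial zero = refl
  partial (suc n) = begin
    sumTo n yS + yS (suc n) ≡⟨ cong₂ _+_ (partial n) (y-suc n) ⟩
    ι n + 1ℚ                ≡⟨ ℚP.+-comm (ι n) 1ℚ ⟩
    1ℚ + ι n                ≡⟨ sym (ι-suc n) ⟩
    ι (suc n)               ∎

θ-inv : θ inv ≈ (yS ⊛ inv)
θ-inv n = trans (ℚP.*-identityʳ (ι n)) (sym (y⊛inv-coeff n))

θ-y : θ yS ≈ (yS ⊛ inv)
θ-y zero = refl
θ-y (suc n) = trans (cong (ι (suc n) *_) (y-suc n)) (trans (ℚP.*-identityʳ (ι (suc n))) (sym (y⊛inv-coeff (suc n))))

θ-log : θ L ≈ negS yS
θ-log zero = refl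
θ-log (suc n) = begin
  ι (suc n) * (- (ℤ.+ 1 / suc n)) ≡⟨ sym (ℚP.neg-distribʳ-* (ι (suc n)) _) ⟩
  - (ι (suc n) * (ℤ.+ 1 / suc n)) ≡⟨ cong -_ (ι-inverse n) ⟩
  - 1ℚ                            ≡⟨ cong -_ (sym (y-suc n)) ⟩
  - yS (suc n)                    ∎

θ-invPow : ∀ a → θ (powS inv a) ≈ scaleS (ι a) (yS ⊛ powS inv a)
θ-invPow zero zero = sym (ℚP.*-zeroˡ ((yS ⊛ oneS) zero))
θ-invPow zero (suc n) = trans (ℚP.*-zeroʳ (ι (suc n))) (sym (ℚP.*-zeroˡ ((yS ⊛ oneS) (suc n))))
θ-invPow (suc a) n = begin
  θ (P ⊛ inv) n
    ≡⟨ θ-Leibniz P inv n ⟩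
  (θ P ⊛ inv) n + (P ⊛ θ inv) n
    ≡⟨ cong₂ _+_ (⊛-congˡ inv (θ-invPow a) n) (⊛-congʳ P θ-inv n) ⟩
  (scaleS (ι a) (yS ⊛ P) ⊛ inv) n + (P ⊛ (yS ⊛ inv)) n
    ≡⟨ cong₂ _+_ (⊛-scaleˡ (ι a) (yS ⊛ P) inv n) (regroup n) ⟩
  ι a * ((yS ⊛ P) ⊛ inv) n + ((yS ⊛ P) ⊛ inv) n
    ≡⟨ ι-suc-* a (((yS ⊛ P) ⊛ inv) n) ⟩
  ι (suc a) * ((yS ⊛ P) ⊛ inv) n
    ≡⟨ cong (ι (suc a) *_) (⊛-assoc yS P inv n) ⟩
  ι (suc a) * (yS ⊛ (P ⊛ inv)) n ∎
  where
  P : PS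
  P = powS inv a
  regroup : (P ⊛ (yS ⊛ inv)) ≈ ((yS ⊛ P) ⊛ inv)
  regroup = ≈-trans (≈-sym (⊛-assoc P yS inv)) (⊛-congˡ inv (⊛-comm P yS))

θ-yPow : ∀ k → θ (powS yS k) ≈ scaleS (ι k) (powS yS k ⊛ inv)
θ-yPow zero zero = sym (ℚP.*-zeroˡ ((oneS ⊛ inv) zero))
θ-yPow zero (suc n) = trans (ℚP.*-zeroʳ (ι (suc n))) (sym (ℚP.*-zeroˡ ((oneS ⊛ inv) (suc n))))
θ-yPow (suc k) n = begin
  θ (Y ⊛ yS) n
    ≡⟨ θ-Leibniz Y yS n ⟩
  (θ Y ⊛ yS) n + (Y ⊛ θ yS) n
    ≡⟨ cong₂ _+_ (⊛-congˡ yS (θ-yPow k) n) (⊛-congʳ Y θ-y n) ⟩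
  (scaleS (ι k) (Y ⊛ inv) ⊛ yS) n + (Y ⊛ (yS ⊛ inv)) n
    ≡⟨ cong₂ _+_ (trans (⊛-scaleˡ (ι k) (Y ⊛ inv) yS n) (cong (ι k *_) (⊛-swapʳ Y inv yS n)))
                 (sym (⊛-assoc Y yS inv n)) ⟩
  ι k * ((Y ⊛ yS) ⊛ inv) n + ((Y ⊛ yS) ⊛ inv) n
    ≡⟨ ι-suc-* k (((Y ⊛ yS) ⊛ inv) n) ⟩
  ι (suc k) * ((Y ⊛ yS) ⊛ inv) n ∎
  where
  Y : PS
  Y = powS yS k

IsLadder : (ℕ → PS) → Set
IsLadder U = ∀ k → θ (U k) ≈ (scaleS (ι k) (U k) ⊕ U (suc k))

-- The ladder equation determines U_{k+1} = θ U_k - k U_k from U_k, so a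
-- θ-ladder is determined by its bottom rung.
ladder-unique : ∀ {U V} → IsLadder U → IsLadder V → U 0 ≈ V 0 → ∀ k → U k ≈ V k
ladder-unique {U} {V} hU hV h0 zero = h0
ladder-unique {U} {V} hU hV h0 (suc k) n = begin
  U (suc k) n               ≡⟨ next hU n ⟩
  θ (U k) n - ι k * U k n   ≡⟨ cong₂ (λ u v → ι n * u - ι k * v) (IH n) (IH n) ⟩
  θ (V k) n - ι k * V k n   ≡⟨ sym (next hV n) ⟩
  V (suc k) n               ∎
  where
  IH : U k ≈ V k
  IH = ladder-unique hU hV h0 k
  next : ∀ {W} → IsLadder W → ∀ n → W (suc k) n ≡ θ (W k) n - ι k * W k n
  next {W} hW n = trans (solve 2 (λ u v → v := (u :+ v) :- u) refl (ι k * W k n) (W (suc k) n))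
                        (cong (_- ι k * W k n) (sym (hW k n)))

-- For fixed a, let  Q_k = (1-x)^{-a} y^k  and
-- QL_k = Q_k ln(1-x).  Since θ acts on both by raising k, the
-- combinations  B_k = c_k Q_k - d_k QL_k  form a θ-ladder as soon as
--   c_{k+1} = (a+k) c_k + d_k   and   d_{k+1} = (a+k) d_k.

module _ (a : ℕ) where

  Q : ℕ → PS
  Q k = powS inv a ⊛ powS yS k

  QL : ℕ → PS
  QL k = Q k ⊛ L

  Q-⊛y : ∀ k → (Q k ⊛ yS) ≈ Q (suc k)
  Q-⊛y k = ⊛-assoc (powS inv a) (powS yS k) yS

  -- θ Q_k = k Q_k + (a+k) Q_{k+1}, using 1/(1-x) = 1 + y
  θ-Q : ∀ k → θ (Q k) ≈ (scaleS (ι k) (Q k) ⊕ scaleS (ι a + ι k) (Q (suc k)))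
  θ-Q k n = begin
    θ (P ⊛ Y) n
      ≡⟨ θ-Leibniz P Y n ⟩
    (θ P ⊛ Y) n + (P ⊛ θ Y) n
      ≡⟨ cong₂ _+_ (⊛-congˡ Y (θ-invPow a) n) (⊛-congʳ P (θ-yPow k) n) ⟩
    (scaleS (ι a) (yS ⊛ P) ⊛ Y) n + (P ⊛ scaleS (ι k) (Y ⊛ inv)) n
      ≡⟨ cong₂ _+_ (trans (⊛-scaleˡ (ι a) (yS ⊛ P) Y n) (cong (ι a *_) (yPY n)))
                   (trans (⊛-scaleʳ (ι k) P (Y ⊛ inv) n) (cong (ι k *_) (PYinv n))) ⟩
    ι a * Q (suc k) n + ι k * (Q k n + Q (suc k) n)
      ≡⟨ solve 4 (λ A K q₀ q₁ → A :* q₁ :+ K :* (q₀ :+ q₁) := K :* q₀ :+ (A :+ K) :* q₁) refl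
           (ι a) (ι k) (Q k n) (Q (suc k) n) ⟩
    ι k * Q k n + (ι a + ι k) * Q (suc k) n ∎
    where
    P : PS
    P = powS inv a
    Y : PS
    Y = powS yS k
    yPY : ((yS ⊛ P) ⊛ Y) ≈ Q (suc k)
    yPY = ≈-trans (⊛-congˡ Y (⊛-comm yS P)) (≈-trans (⊛-swapʳ P yS Y) (Q-⊛y k))
    PYinv : (P ⊛ (Y ⊛ inv)) ≈ (Q k ⊕ Q (suc k))
    PYinv = ≈-trans (≈-sym (⊛-assoc P Y inv))
            (≈-trans (⊛-congʳ (Q k) inv≈one⊕y)
            (≈-trans (⊛-distribˡ-⊕ (Q k) oneS yS)
            (λ n → cong₂ _+_ (⊛-identityʳ (Q k) n) (Q-⊛y k n))))

  -- θ QL_k = k QL_k + (a+k) QL_{k+1} - Q_{k+1}, using θ ln(1-x) = -y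
  θ-QL : ∀ k n → θ (QL k) n ≡ ι k * QL k n + (ι a + ι k) * QL (suc k) n - Q (suc k) n
  θ-QL k n = begin
    θ (Q k ⊛ L) n
      ≡⟨ θ-Leibniz (Q k) L n ⟩
    (θ (Q k) ⊛ L) n + (Q k ⊛ θ L) n
      ≡⟨ cong₂ _+_ (⊛-congˡ L (θ-Q k) n) (⊛-congʳ (Q k) θ-log n) ⟩
    ((scaleS (ι k) (Q k) ⊕ scaleS (ι a + ι k) (Q (suc k))) ⊛ L) n + (Q k ⊛ negS yS) n
      ≡⟨ cong₂ _+_ (trans (⊛-distribʳ-⊕ L (scaleS (ι k) (Q k)) (scaleS (ι a + ι k) (Q (suc k))) n)
                          (cong₂ _+_ (⊛-scaleˡ (ι k) (Q k) L n) (⊛-scaleˡ (ι a + ι k) (Q (suc k)) L n)))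
                   (trans (⊛-negʳ (Q k) yS n) (cong -_ (Q-⊛y k n))) ⟩
    ι k * QL k n + (ι a + ι k) * QL (suc k) n - Q (suc k) n ∎

  B : (c d : ℕ → ℚ) → ℕ → PS
  B c d k n = c k * Q k n - d k * QL k n

  B-ladder : (c d : ℕ → ℚ) →
    (∀ k → c (suc k) ≡ (ι a + ι k) * c k + d k) →
    (∀ k → d (suc k) ≡ (ι a + ι k) * d k) →
    IsLadder (B c d)
  B-ladder c d c-rec d-rec k n = begin
    ι n * (c k * Q k n - d k * QL k n)
      ≡⟨ solve 5 (λ N c d q l → N :* (c :* q :- d :* l) := c :* (N :* q) :- d :* (N :* l)) refl
           (ι n) (c k) (d k) (Q k n) (QL k n) ⟩
    c k * θ (Q k) n - d k * θ (QL k) n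
      ≡⟨ cong₂ (λ u v → c k * u - d k * v) (θ-Q k n) (θ-QL k n) ⟩
    c k * (ι k * Q k n + A * Q (suc k) n) - d k * (ι k * QL k n + A * QL (suc k) n - Q (suc k) n)
      ≡⟨ solve 8 (λ c d K A q₀ q₁ l₀ l₁ →
            c :* (K :* q₀ :+ A :* q₁) :- d :* (K :* l₀ :+ A :* l₁ :- q₁)
            := K :* (c :* q₀ :- d :* l₀) :+ ((A :* c :+ d) :* q₁ :- (A :* d) :* l₁)) refl
            (c k) (d k) (ι k) A (Q k n) (Q (suc k) n) (QL k n) (QL (suc k) n) ⟩
    ι k * B c d k n + ((A * c k + d k) * Q (suc k) n - (A * d k) * QL (suc k) n)
      ≡⟨ cong₂ (λ u v → ι k * B c d k n + (u * Q (suc k) n - v * QL (suc k) n)) (sym (c-rec k)) (sym (d-rec k)) ⟩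
    ι k * B c d k n + B c d (suc k) n ∎
    where
    A : ℚ
    A = ι a + ι k

falling : ℕ → ℕ → ℕ
falling n zero = 1
falling zero (suc k) = 0
falling (suc n) (suc k) = suc n ℕ.* falling n k

falling-step : ∀ n k → n ℕ.* falling n k ≡ k ℕ.* falling n k ℕ.+ falling n (suc k)
falling-step zero zero = refl
falling-step zero (suc k) = sym (trans (ℕP.+-identityʳ (k ℕ.* 0)) (ℕP.*-zeroʳ k))
falling-step (suc n) zero = refl
falling-step (suc n) (suc k) = begin
  suc n ℕ.* (suc n ℕ.* falling n k)
    ≡⟨ cong (suc n ℕ.*_) inner ⟩
  suc n ℕ.* (suc k ℕ.* falling n k ℕ.+ falling n (suc k))
    ≡⟨ rearrange (suc n) (suc k) (falling n k) (falling n (suc k)) ⟩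
  suc k ℕ.* (suc n ℕ.* falling n k) ℕ.+ suc n ℕ.* falling n (suc k) ∎
  where
  rearrange : ∀ n k f g → n ℕ.* (k ℕ.* f ℕ.+ g) ≡ k ℕ.* (n ℕ.* f) ℕ.+ n ℕ.* g
  rearrange = solve-∀
  inner : suc n ℕ.* falling n k ≡ suc k ℕ.* falling n k ℕ.+ falling n (suc k)
  inner = trans (cong (falling n k ℕ.+_) (falling-step n k))
                (sym (ℕP.+-assoc (falling n k) (k ℕ.* falling n k) (falling n (suc k))))

binomial*factorial : ∀ n k → (n C k) ℕ.* k ! ≡ falling n k
binomial*factorial n zero = refl
binomial*factorial zero (suc k) = refl
binomial*factorial (suc n) (suc k) = begin
  (suc n C suc k) ℕ.* (suc k ℕ.* k !)
    ≡⟨ cong (ℕ._* (suc k ℕ.* k !)) (sym (nCk+nC[k+1]≡[n+1]C[k+1] n k)) ⟩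
  ((n C k) ℕ.+ (n C suc k)) ℕ.* (suc k ℕ.* k !)
    ≡⟨ rearrange (n C k) (n C suc k) (suc k) (k !) ⟩
  suc k ℕ.* ((n C k) ℕ.* k !) ℕ.+ (n C suc k) ℕ.* (suc k ℕ.* k !)
    ≡⟨ cong₂ (λ u v → suc k ℕ.* u ℕ.+ v) (binomial*factorial n k) (binomial*factorial n (suc k)) ⟩
  suc k ℕ.* falling n k ℕ.+ falling n (suc k)
    ≡⟨ ℕP.+-assoc (falling n k) (k ℕ.* falling n k) (falling n (suc k)) ⟩
  falling n k ℕ.+ (k ℕ.* falling n k ℕ.+ falling n (suc k))
    ≡⟨ cong (falling n k ℕ.+_) (sym (falling-step n k)) ⟩
  suc n ℕ.* falling n k ∎
  where
  rearrange : ∀ a b k f → (a ℕ.+ b) ℕ.* (k ℕ.* f) ≡ k ℕ.* (a ℕ.* f) ℕ.+ b ℕ.* (k ℕ.* f)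
  rearrange = solve-∀

rising-one : ∀ k → rising 1 k ≡ k !
rising-one zero = refl
rising-one (suc k) = trans (ℕP.*-comm (rising 1 k) (suc k)) (cong (suc k ℕ.*_) (rising-one k))

rising-shift : ∀ a k → rising a (suc k) ≡ a ℕ.* rising (suc a) k
rising-shift a zero = trans (ℕP.*-identityˡ (a ℕ.+ 0)) (trans (ℕP.+-identityʳ a) (sym (ℕP.*-identityʳ a)))
rising-shift a (suc k) = begin
  rising a (suc k) ℕ.* (a ℕ.+ suc k)          ≡⟨ cong₂ ℕ._*_ (rising-shift a k) (ℕP.+-suc a k) ⟩
  a ℕ.* rising (suc a) k ℕ.* (suc a ℕ.+ k)    ≡⟨ ℕP.*-assoc a _ _ ⟩
  a ℕ.* (rising (suc a) k ℕ.* (suc a ℕ.+ k))  ∎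

hyperharmonic-zero : ∀ b → hyperharmonic (suc b) 0 ≡ 0ℚ
hyperharmonic-zero zero = refl
hyperharmonic-zero (suc b) = refl

hyperharmonic-partialSum : ∀ b n → hyperharmonic (suc (suc b)) n ≡ sumTo n (hyperharmonic (suc b))
hyperharmonic-partialSum b zero = sym (hyperharmonic-zero b)
hyperharmonic-partialSum b (suc n) = cong (_+ hyperharmonic (suc b) (suc n)) (hyperharmonic-partialSum b n)

-- Σ_n H^{(b+1)}_n x^n = -(1-x)^{-(b+1)} ln(1-x), since H_n = -Σ_{k≤n} [x^k] ln(1-x)
-- and each further order takes partial sums.
hyperharmonic-gf : ∀ b → hyperharmonic (suc b) ≈ negS (powS inv (suc b) ⊛ L)
hyperharmonic-gf zero n = begin
  harmonic n                    ≡⟨ solve 1 (λ x → x := :- :- x) refl (harmonic n) ⟩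
  - - harmonic n                ≡⟨ cong -_ (sym (log-partialSum n)) ⟩
  - sumTo n L                   ≡⟨ cong -_ (sym (partialSums L n)) ⟩
  - (inv ⊛ L) n                 ≡⟨ cong -_ (⊛-congˡ L (≈-sym (⊛-identityˡ inv)) n) ⟩
  - ((oneS ⊛ inv) ⊛ L) n        ∎
  where
  log-partialSum : ∀ n → sumTo n L ≡ - harmonic n
  log-partialSum zero = refl
  log-partialSum (suc n) = trans (cong (_+ (- (ℤ.+ 1 / suc n))) (log-partialSum n))
                                 (sym (ℚP.neg-distrib-+ (harmonic n) (ℤ.+ 1 / suc n)))
hyperharmonic-gf (suc b) n = begin
  hyperharmonic (suc (suc b)) n   ≡⟨ hyperharmonic-partialSum b n ⟩
  sumTo n (hyperharmonic (suc b)) ≡⟨ sym (partialSums _ n) ⟩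
  (inv ⊛ hyperharmonic (suc b)) n ≡⟨ ⊛-congʳ inv (hyperharmonic-gf b) n ⟩
  (inv ⊛ negS (P ⊛ L)) n          ≡⟨ ⊛-negʳ inv (P ⊛ L) n ⟩
  - (inv ⊛ (P ⊛ L)) n             ≡⟨ cong -_ (≈-trans (≈-sym (⊛-assoc inv P L)) (⊛-congˡ L (⊛-comm inv P)) n) ⟩
  - ((P ⊛ inv) ⊛ L) n             ∎
  where
  P : PS
  P = powS inv (suc b)

factorialHyper : ℕ → ℕ → ℚ
factorialHyper a k = ι (k !) * hyperharmonic a k

risingℚ : ℕ → ℕ → ℚ
risingℚ a k = ι (rising a k)

risingℚ-step : ∀ a k → risingℚ a (suc k) ≡ (ι a + ι k) * risingℚ a k
risingℚ-step a k = begin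
  ι (rising a k ℕ.* (a ℕ.+ k))      ≡⟨ ι-* (rising a k) (a ℕ.+ k) ⟩
  ι (rising a k) * ι (a ℕ.+ k)      ≡⟨ cong (ι (rising a k) *_) (ι-+ a k) ⟩
  ι (rising a k) * (ι a + ι k)      ≡⟨ ℚP.*-comm (ι (rising a k)) _ ⟩
  (ι a + ι k) * ι (rising a k)      ∎

-- The field identity behind the inductive step of the closed form below;
-- u = 1/(b+1) and v = 1/(b+k+2) enter only through  Bs u = 1,  (Bs+Ks) v = 1.
closed-form-algebra : ∀ Ks Bs R X h u v → Bs * u ≡ 1ℚ → (Bs + Ks) * v ≡ 1ℚ →
  Ks * (R * (X - (h + u))) + Bs * R * (X - h) ≡ R * (Bs + Ks) * (X + v - (h + u))
closed-form-algebra Ks Bs R X h u v Bs*u≡1 BsKs*v≡1 = begin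
  Ks * (R * (X - (h + u))) + Bs * R * (X - h)
    ≡⟨ solve 7 (λ Ks Bs R X h u v → Ks :* (R :* (X :- (h :+ u))) :+ Bs :* R :* (X :- h)
         := R :* (Bs :+ Ks) :* (X :+ v :- (h :+ u)) :- R :* ((Bs :+ Ks) :* v) :+ R :* (Bs :* u))
         refl Ks Bs R X h u v ⟩
  rhs - R * ((Bs + Ks) * v) + R * (Bs * u)
    ≡⟨ cong₂ (λ p q → rhs - R * p + R * q) BsKs*v≡1 Bs*u≡1 ⟩
  rhs - R * 1ℚ + R * 1ℚ
    ≡⟨ solve 2 (λ x R → x :- R :* con 1ℚ :+ R :* con 1ℚ := x) refl rhs R ⟩
  rhs ∎
  where
  rhs : ℚ
  rhs = R * (Bs + Ks) * (X + v - (h + u))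

hyperharmonic-closed : ∀ b k → factorialHyper (suc b) k ≡ risingℚ (suc b) k * (harmonic (k ℕ.+ b) - harmonic b)
hyperharmonic-closed zero k = begin
  ι (k !) * harmonic k
    ≡⟨ cong₂ (λ p q → ι p * q) (sym (rising-one k)) (cong harmonic (sym (ℕP.+-identityʳ k))) ⟩
  ι (rising 1 k) * harmonic (k ℕ.+ 0)
    ≡⟨ cong (ι (rising 1 k) *_) (solve 1 (λ x → x := x :- con 0ℚ) refl (harmonic (k ℕ.+ 0))) ⟩
  ι (rising 1 k) * (harmonic (k ℕ.+ 0) - 0ℚ) ∎
hyperharmonic-closed (suc b) zero =
  sym (solve 1 (λ x → con 1ℚ :* (x :- x) := con 0ℚ) refl (harmonic (suc b)))
hyperharmonic-closed (suc b) (suc k) = begin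
  ι (suc k !) * (hyperharmonic (suc (suc b)) k + hyperharmonic (suc b) (suc k))
    ≡⟨ ℚP.*-distribˡ-+ (ι (suc k !)) _ _ ⟩
  ι (suc k !) * hyperharmonic (suc (suc b)) k + factorialHyper (suc b) (suc k)
    ≡⟨ cong (_+ factorialHyper (suc b) (suc k))
            (trans (cong (_* hyperharmonic (suc (suc b)) k) (ι-* (suc k) (k !))) (ℚP.*-assoc Ks (ι (k !)) _)) ⟩
  Ks * factorialHyper (suc (suc b)) k + factorialHyper (suc b) (suc k)
    ≡⟨ cong₂ (λ p q → Ks * p + q) (hyperharmonic-closed (suc b) k) (hyperharmonic-closed b (suc k)) ⟩
  Ks * (R * (X - (h + u))) + ι (rising (suc b) (suc k)) * (harmonic (suc (k ℕ.+ b)) - h)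
    ≡⟨ cong₂ (λ p q → Ks * (R * (X - (h + u))) + p * (harmonic q - h))
             (trans (cong ι (rising-shift (suc b) k)) (ι-* (suc b) (rising (suc (suc b)) k)))
             (sym (ℕP.+-suc k b)) ⟩
  Ks * (R * (X - (h + u))) + Bs * R * (X - h)
    ≡⟨ closed-form-algebra Ks Bs R X h u v (ι-inverse b) BsKs*v≡1 ⟩
  R * (Bs + Ks) * (X + v - (h + u))
    ≡⟨ cong (λ p → R * p * (X + v - (h + u))) (sym b+k+2≡BsKs) ⟩
  R * ι (suc (suc b) ℕ.+ k) * (X + v - (h + u))
    ≡⟨ cong (_* (X + v - (h + u))) (sym (ι-* (rising (suc (suc b)) k) (suc (suc b) ℕ.+ k))) ⟩
  risingℚ (suc (suc b)) (suc k) * (harmonic (suc k ℕ.+ suc b) - harmonic (suc b)) ∎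
  where
  Ks Bs R X h u v : ℚ
  Ks = ι (suc k)
  Bs = ι (suc b)
  R = ι (rising (suc (suc b)) k)
  X = harmonic (k ℕ.+ suc b)
  h = harmonic b
  u = ℤ.+ 1 / suc b
  v = ℤ.+ 1 / suc (k ℕ.+ suc b)
  b+k+2≡BsKs : ι (suc (suc b) ℕ.+ k) ≡ Bs + Ks
  b+k+2≡BsKs = trans (cong ι (sym (ℕP.+-suc (suc b) k))) (ι-+ (suc b) (suc k))
  BsKs*v≡1 : (Bs + Ks) * v ≡ 1ℚ
  BsKs*v≡1 = trans (cong (_* v) (trans (sym b+k+2≡BsKs) (cong (λ z → ι (suc z)) (ℕP.+-comm (suc b) k))))
                   (ι-inverse (k ℕ.+ suc b))

factorialHyper-step : ∀ b k →
  factorialHyper (suc b) (suc k) ≡ (ι (suc b) + ι k) * factorialHyper (suc b) k + risingℚ (suc b) k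
factorialHyper-step b k = begin
  factorialHyper (suc b) (suc k)
    ≡⟨ hyperharmonic-closed b (suc k) ⟩
  ι (rising (suc b) k ℕ.* (suc b ℕ.+ k)) * (harmonic (suc (k ℕ.+ b)) - h)
    ≡⟨ cong (_* (harmonic (suc (k ℕ.+ b)) - h)) (trans (ι-* (rising (suc b) k) (suc b ℕ.+ k)) (cong (D *_) (ι-+ (suc b) k))) ⟩
  D * A * (X + w - h)
    ≡⟨ solve 5 (λ D A X w h → D :* A :* (X :+ w :- h) := A :* (D :* (X :- h)) :+ D :* (A :* w)) refl D A X w h ⟩
  A * (D * (X - h)) + D * (A * w)
    ≡⟨ cong₂ (λ p q → A * p + D * q) (sym (hyperharmonic-closed b k)) A*w≡1 ⟩
  A * factorialHyper (suc b) k + D * 1ℚ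
    ≡⟨ cong (A * factorialHyper (suc b) k +_) (ℚP.*-identityʳ D) ⟩
  A * factorialHyper (suc b) k + D ∎
  where
  D A X w h : ℚ
  D = risingℚ (suc b) k
  A = ι (suc b) + ι k
  X = harmonic (k ℕ.+ b)
  w = ℤ.+ 1 / suc (k ℕ.+ b)
  h = harmonic b
  A*w≡1 : A * w ≡ 1ℚ
  A*w≡1 = trans (cong (_* w) (trans (sym (ι-+ (suc b) k)) (cong (λ z → ι (suc z)) (ℕP.+-comm b k))))
                (ι-inverse (k ℕ.+ b))

-- The ladder E_k = Σ_n n^{(k)} H^{(a)}_n x^n, whose bottom rung is the
-- generating function of H^{(a)}; by uniqueness it coincides with the
-- closed-form ladder built from k! H^{(a)}_k and a^{(k)}.

E : ℕ → ℕ → PS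
E a k n = ι (falling n k) * hyperharmonic a n

-- from  n n^{(k)} = k n^{(k)} + n^{(k+1)}
E-ladder : ∀ a → IsLadder (E a)
E-ladder a k n = begin
  ι n * (ι F * h)             ≡⟨ sym (ℚP.*-assoc (ι n) (ι F) h) ⟩
  ι n * ι F * h               ≡⟨ cong (_* h) (sym (ι-* n F)) ⟩
  ι (n ℕ.* F) * h             ≡⟨ cong (λ z → ι z * h) (falling-step n k) ⟩
  ι (k ℕ.* F ℕ.+ F′) * h      ≡⟨ cong (_* h) (trans (ι-+ (k ℕ.* F) F′) (cong (_+ ι F′) (ι-* k F))) ⟩
  (ι k * ι F + ι F′) * h      ≡⟨ solve 4 (λ K f f′ h → (K :* f :+ f′) :* h := K :* (f :* h) :+ f′ :* h) refl (ι k) (ι F) (ι F′) h ⟩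
  ι k * (ι F * h) + ι F′ * h  ∎
  where
  F F′ : ℕ
  F = falling n k
  F′ = falling n (suc k)
  h : ℚ
  h = hyperharmonic a n

BH : ℕ → ℕ → PS
BH b = B (suc b) (factorialHyper (suc b)) (risingℚ (suc b))

BH-ladder : ∀ b → IsLadder (BH b)
BH-ladder b = B-ladder (suc b) (factorialHyper (suc b)) (risingℚ (suc b))
                       (factorialHyper-step b) (risingℚ-step (suc b))

-- E_k = B_k: both are ladders with bottom rung Σ_n H^{(b+1)}_n x^n.
E≈BH : ∀ b k → E (suc b) k ≈ BH b k
E≈BH b = ladder-unique (E-ladder (suc b)) (BH-ladder b) bottom
  where
  P : PS
  P = powS inv (suc b)
  -- both bottom rungs are  Σ_n H^{(b+1)}_n x^n = -(1-x)^{-(b+1)} ln(1-x)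
  bottom : E (suc b) 0 ≈ BH b 0
  bottom n = begin
    1ℚ * hyperharmonic (suc b) n
      ≡⟨ ℚP.*-identityˡ _ ⟩
    hyperharmonic (suc b) n
      ≡⟨ hyperharmonic-gf b n ⟩
    - (P ⊛ L) n
      ≡⟨ cong -_ (⊛-congˡ L (≈-sym (⊛-identityʳ P)) n) ⟩
    - QL (suc b) 0 n
      ≡⟨ solve 2 (λ q l → :- l := con 1ℚ :* con 0ℚ :* q :- con 1ℚ :* l) refl (Q (suc b) 0 n) (QL (suc b) 0 n) ⟩
    1ℚ * 0ℚ * Q (suc b) 0 n - 1ℚ * QL (suc b) 0 n
      ≡⟨ cong (λ z → 1ℚ * z * Q (suc b) 0 n - 1ℚ * QL (suc b) 0 n) (sym (hyperharmonic-zero b)) ⟩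
    BH b 0 n ∎

rStirling-unfold : ∀ r m k → r ≤ m → rStirling r m k ≡ rStirAux r (m ∸ r) k
rStirling-unfold r m k r≤m =
  cong (λ t → if t then 0 else rStirAux r (m ∸ r) k) (dec-false (m ℕP.<? r) (ℕP.≤⇒≯ r≤m))

rStirAux-vanish : ∀ r d k → r ℕ.+ d < k → rStirAux r d k ≡ 0
rStirAux-vanish r zero k r+0<k =
  cong (λ t → if t then 1 else 0)
       (dec-false (k ℕP.≟ r) (λ k≡r → ℕP.<-irrefl (sym k≡r) (subst (_< k) (ℕP.+-identityʳ r) r+0<k)))
rStirAux-vanish r (suc d) (suc k) r+1+d<1+k = begin
  suc k ℕ.* rStirAux r d (suc k) ℕ.+ rStirAux r d k
    ≡⟨ cong₂ (λ p q → suc k ℕ.* p ℕ.+ q) (rStirAux-vanish r d (suc k) (ℕP.m<n⇒m<1+n r+d<k))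
                                         (rStirAux-vanish r d k r+d<k) ⟩
  suc k ℕ.* 0 ℕ.+ 0
    ≡⟨ trans (ℕP.+-identityʳ (suc k ℕ.* 0)) (ℕP.*-zeroʳ (suc k)) ⟩
  0 ∎
  where
  r+d<k : r ℕ.+ d < k
  r+d<k = ℕP.≤-pred (subst (_< suc k) (ℕP.+-suc r d) r+1+d<1+k)

rStirling-vanish : ∀ {r m k} → r ≤ m → m < k → rStirling r m k ≡ 0
rStirling-vanish {r} {m} {k} r≤m m<k =
  trans (rStirling-unfold r m k r≤m) (rStirAux-vanish r (m ∸ r) k (subst (_< k) (sym (ℕP.m+[n∸m]≡n r≤m)) m<k))

rStirling-diagonal : ∀ r → rStirling r r r ≡ 1
rStirling-diagonal r =
  trans (rStirling-unfold r r r ℕP.≤-refl)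
        (trans (cong (λ d → rStirAux r d r) (ℕP.n∸n≡0 r))
               (cong (λ t → if t then 1 else 0) (dec-true (r ℕP.≟ r) refl)))

rStirling-belowDiagonal : ∀ {r k} → k < r → rStirling r r k ≡ 0
rStirling-belowDiagonal {r} {k} k<r =
  trans (rStirling-unfold r r k ℕP.≤-refl)
        (trans (cong (λ d → rStirAux r d k) (ℕP.n∸n≡0 r))
               (cong (λ t → if t then 1 else 0) (dec-false (k ℕP.≟ r) (ℕP.<⇒≢ k<r))))

rStirling-column0 : ∀ {r m} → r ≤ m → rStirling r (suc m) 0 ≡ 0
rStirling-column0 {r} {m} r≤m =
  trans (rStirling-unfold r (suc m) 0 (ℕP.m≤n⇒m≤1+n r≤m)) (cong (λ d → rStirAux r d 0) (ℕP.+-∸-assoc 1 r≤m))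

rStirling-step : ∀ {r m} k → r ≤ m →
  rStirling r (suc m) (suc k) ≡ suc k ℕ.* rStirling r m (suc k) ℕ.+ rStirling r m k
rStirling-step {r} {m} k r≤m = begin
  rStirling r (suc m) (suc k)
    ≡⟨ rStirling-unfold r (suc m) (suc k) (ℕP.m≤n⇒m≤1+n r≤m) ⟩
  rStirAux r (suc m ∸ r) (suc k)
    ≡⟨ cong (λ d → rStirAux r d (suc k)) (ℕP.+-∸-assoc 1 r≤m) ⟩
  rStirAux r (suc (m ∸ r)) (suc k)
    ≡⟨ cong₂ (λ p q → suc k ℕ.* p ℕ.+ q) (sym (rStirling-unfold r m (suc k) r≤m)) (sym (rStirling-unfold r m k r≤m)) ⟩
  suc k ℕ.* rStirling r m (suc k) ℕ.+ rStirling r m k ∎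

stirlingTransform : ℕ → (ℕ → PS) → ℕ → PS
stirlingTransform r U m n = sumTo m (λ k → ι (rStirling r m k) * U k n)

stirlingTransform-cong : ∀ r {U V} → (∀ k → U k ≈ V k) → ∀ m → stirlingTransform r U m ≈ stirlingTransform r V m
stirlingTransform-cong r U≈V m n = Σ-ext m (λ k → cong (ι (rStirling r m k) *_) (U≈V k n))

-- {r k}_r = [k = r]
stirlingTransform-base : ∀ r U → stirlingTransform r U r ≈ U r
stirlingTransform-base r U n = begin
  sumTo r (λ k → ι (rStirling r r k) * U k n)
    ≡⟨ Σ-last r _ (λ k k<r → trans (cong (λ z → ι z * U k n) (rStirling-belowDiagonal k<r)) (ℚP.*-zeroˡ (U k n))) ⟩
  ι (rStirling r r r) * U r n
    ≡⟨ trans (cong (λ z → ι z * U r n) (rStirling-diagonal r)) (ℚP.*-identityˡ (U r n)) ⟩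
  U r n ∎

stirlingTransform-step : ∀ r {U} → IsLadder U → ∀ m → r ≤ m →
  stirlingTransform r U (suc m) ≈ θ (stirlingTransform r U m)
stirlingTransform-step r {U} U-ladder m r≤m n = begin
  sumTo (suc m) (λ k → ι (S′ k) * U k n)
    ≡⟨ Σ-head m (λ k → ι (S′ k) * U k n) ⟩
  ι (S′ 0) * U 0 n + sumTo m (λ k → ι (S′ (suc k)) * U (suc k) n)
    ≡⟨ cong₂ _+_ (trans (cong (λ z → ι z * U 0 n) (rStirling-column0 r≤m)) (ℚP.*-zeroˡ (U 0 n)))
                 (Σ-ext m pascal) ⟩
  0ℚ + sumTo m (λ k → h (suc k) + ι (S k) * U (suc k) n)
    ≡⟨ trans (ℚP.+-identityˡ _) (Σ-+ m (λ k → h (suc k)) (λ k → ι (S k) * U (suc k) n)) ⟩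
  sumTo m (λ k → h (suc k)) + sumTo m (λ k → ι (S k) * U (suc k) n)
    ≡⟨ cong (_+ sumTo m (λ k → ι (S k) * U (suc k) n)) (Σ-shift m h h0≡0 h[m+1]≡0) ⟩
  sumTo m h + sumTo m (λ k → ι (S k) * U (suc k) n)
    ≡⟨ sym (Σ-+ m h (λ k → ι (S k) * U (suc k) n)) ⟩
  sumTo m (λ k → h k + ι (S k) * U (suc k) n)
    ≡⟨ Σ-ext m ladder ⟩
  sumTo m (λ k → ι n * (ι (S k) * U k n))
    ≡⟨ Σ-*ˡ m (ι n) (λ k → ι (S k) * U k n) ⟩
  ι n * stirlingTransform r U m n ∎
  where
  S S′ : ℕ → ℕ
  S = rStirling r m
  S′ = rStirling r (suc m)
  h : ℕ → ℚ
  h k = ι k * ι (S k) * U k n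
  h0≡0 : h 0 ≡ 0ℚ
  h0≡0 = trans (cong (_* U 0 n) (ℚP.*-zeroˡ (ι (S 0)))) (ℚP.*-zeroˡ (U 0 n))
  h[m+1]≡0 : h (suc m) ≡ 0ℚ
  h[m+1]≡0 = trans (cong (λ z → ι (suc m) * ι z * U (suc m) n) (rStirling-vanish r≤m ℕP.≤-refl))
                   (trans (cong (_* U (suc m) n) (ℚP.*-zeroʳ (ι (suc m)))) (ℚP.*-zeroˡ (U (suc m) n)))
  pascal : ∀ k → ι (S′ (suc k)) * U (suc k) n ≡ h (suc k) + ι (S k) * U (suc k) n
  pascal k = begin
    ι (S′ (suc k)) * U (suc k) n
      ≡⟨ cong (λ z → ι z * U (suc k) n) (rStirling-step k r≤m) ⟩
    ι (suc k ℕ.* S (suc k) ℕ.+ S k) * U (suc k) n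
      ≡⟨ cong (_* U (suc k) n) (trans (ι-+ (suc k ℕ.* S (suc k)) (S k)) (cong (_+ ι (S k)) (ι-* (suc k) (S (suc k))))) ⟩
    (ι (suc k) * ι (S (suc k)) + ι (S k)) * U (suc k) n
      ≡⟨ ℚP.*-distribʳ-+ (U (suc k) n) (ι (suc k) * ι (S (suc k))) (ι (S k)) ⟩
    h (suc k) + ι (S k) * U (suc k) n ∎
  ladder : ∀ k → h k + ι (S k) * U (suc k) n ≡ ι n * (ι (S k) * U k n)
  ladder k = begin
    ι k * ι (S k) * U k n + ι (S k) * U (suc k) n
      ≡⟨ solve 4 (λ K s u u′ → K :* s :* u :+ s :* u′ := s :* (K :* u :+ u′)) refl (ι k) (ι (S k)) (U k n) (U (suc k) n) ⟩
    ι (S k) * (ι k * U k n + U (suc k) n)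
      ≡⟨ cong (ι (S k) *_) (sym (U-ladder k n)) ⟩
    ι (S k) * (ι n * U k n)
      ≡⟨ solve 3 (λ s N u → s :* (N :* u) := N :* (s :* u)) refl (ι (S k)) (ι n) (U k n) ⟩
    ι n * (ι (S k) * U k n) ∎

-- The summand  C(k,r) r! k^{m-r} H^{(a)}_k  as a series in k: it is
-- E_r for m = r, and raising m applies θ.  Hence it is the Stirling
-- transform of E at m.

-- C(k,r) = 0 for k < r
term-belowR : ∀ m r a k → k < r → term m r a k ≡ 0ℚ
term-belowR m r a k k<r =
  trans (cong (λ z → ι (z ℕ.* (r !) ℕ.* (k ℕ.^ (m ∸ r))) * hyperharmonic a k) (k>n⇒nCk≡0 k<r))
        (ℚP.*-zeroˡ (hyperharmonic a k))

-- C(n,r) r! = n^{(r)}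
term-diagonal : ∀ r a → term r r a ≈ E a r
term-diagonal r a n = cong (λ z → ι z * hyperharmonic a n) (begin
  (n C r) ℕ.* (r !) ℕ.* (n ℕ.^ (r ∸ r)) ≡⟨ cong (λ z → (n C r) ℕ.* (r !) ℕ.* (n ℕ.^ z)) (ℕP.n∸n≡0 r) ⟩
  (n C r) ℕ.* (r !) ℕ.* 1               ≡⟨ ℕP.*-identityʳ _ ⟩
  (n C r) ℕ.* (r !)                     ≡⟨ binomial*factorial n r ⟩
  falling n r                           ∎)

-- one more factor n
term-θ : ∀ m r a → r ≤ m → term (suc m) r a ≈ θ (term m r a)
term-θ m r a r≤m n = begin
  ι (c ℕ.* (n ℕ.^ (suc m ∸ r))) * H  ≡⟨ cong (λ z → ι (c ℕ.* (n ℕ.^ z)) * H) (ℕP.+-∸-assoc 1 r≤m) ⟩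
  ι (c ℕ.* (n ℕ.* p)) * H            ≡⟨ cong (λ z → ι z * H) (rearrange c n p) ⟩
  ι (n ℕ.* (c ℕ.* p)) * H            ≡⟨ cong (_* H) (ι-* n (c ℕ.* p)) ⟩
  ι n * ι (c ℕ.* p) * H              ≡⟨ ℚP.*-assoc (ι n) (ι (c ℕ.* p)) H ⟩
  ι n * (ι (c ℕ.* p) * H)            ∎
  where
  c p : ℕ
  c = (n C r) ℕ.* (r !)
  p = n ℕ.^ (m ∸ r)
  H : ℚ
  H = hyperharmonic a n
  rearrange : ∀ c n p → c ℕ.* (n ℕ.* p) ≡ n ℕ.* (c ℕ.* p)
  rearrange = solve-∀

term≈stirlingTransform : ∀ a r m → r ≤ m → term m r a ≈ stirlingTransform r (E a) m
term≈stirlingTransform a .zero zero z≤n = ≈-trans (term-diagonal 0 a) (≈-sym (stirlingTransform-base 0 (E a)))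
term≈stirlingTransform a r (suc m) r≤1+m with ℕP.m≤n⇒m<n∨m≡n r≤1+m
... | inj₂ refl = ≈-trans (term-diagonal (suc m) a) (≈-sym (stirlingTransform-base (suc m) (E a)))
... | inj₁ r<1+m =
  ≈-trans (term-θ m r a r≤m)
  (≈-trans (λ n → cong (ι n *_) (term≈stirlingTransform a r m r≤m n))
           (≈-sym (stirlingTransform-step r (E-ladder a) m r≤m)))
  where
  r≤m : r ≤ m
  r≤m = ℕP.m<1+n⇒m≤n r<1+m

bracket : ℕ → ℕ → ℕ → PS
bracket m r a = polyAtY m (rFhCoeff r m a) ⊖ (polyAtY m (rFCoeff r m a) ⊛ L)

invPow⊛bracket : ∀ m r a →
  (powS inv a ⊛ bracket m r a) ≈ stirlingTransform r (B a (factorialHyper a) (risingℚ a)) m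
invPow⊛bracket m r a n = begin
  (P ⊛ (polyAtY m Fh ⊖ (polyAtY m Fc ⊛ L))) n
    ≡⟨ ⊛-distribˡ-⊖ P (polyAtY m Fh) (polyAtY m Fc ⊛ L) n ⟩
  (P ⊛ polyAtY m Fh) n - (P ⊛ (polyAtY m Fc ⊛ L)) n
    ≡⟨ cong₂ _-_ hyper-part log-part ⟩
  sumTo m (λ k → Fh k * Q a k n) - sumTo m (λ k → Fc k * QL a k n)
    ≡⟨ sym (Σ-- m _ _) ⟩
  sumTo m (λ k → Fh k * Q a k n - Fc k * QL a k n)
    ≡⟨ Σ-ext m factor-Stirling ⟩
  stirlingTransform r (B a (factorialHyper a) (risingℚ a)) m n ∎
  where
  P : PS
  P = powS inv a
  Fh Fc : ℕ → ℚ
  Fh = rFhCoeff r m a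
  Fc = rFCoeff r m a
  hyper-part : (P ⊛ polyAtY m Fh) n ≡ sumTo m (λ k → Fh k * Q a k n)
  hyper-part = trans (⊛-sumSʳ m P (λ k → scaleS (Fh k) (powS yS k)) n)
                     (Σ-ext m (λ k → ⊛-scaleʳ (Fh k) P (powS yS k) n))
  log-term : ∀ k → (P ⊛ (scaleS (Fc k) (powS yS k) ⊛ L)) n ≡ Fc k * QL a k n
  log-term k = begin
    (P ⊛ (scaleS (Fc k) (powS yS k) ⊛ L)) n  ≡⟨ ⊛-congʳ P (⊛-scaleˡ (Fc k) (powS yS k) L) n ⟩
    (P ⊛ scaleS (Fc k) (powS yS k ⊛ L)) n    ≡⟨ ⊛-scaleʳ (Fc k) P (powS yS k ⊛ L) n ⟩
    Fc k * (P ⊛ (powS yS k ⊛ L)) n           ≡⟨ cong (Fc k *_) (sym (⊛-assoc P (powS yS k) L n)) ⟩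
    Fc k * QL a k n                          ∎
  log-part : (P ⊛ (polyAtY m Fc ⊛ L)) n ≡ sumTo m (λ k → Fc k * QL a k n)
  log-part = begin
    (P ⊛ (polyAtY m Fc ⊛ L)) n
      ≡⟨ ⊛-congʳ P (⊛-sumSˡ m L (λ k → scaleS (Fc k) (powS yS k))) n ⟩
    (P ⊛ sumS m (λ k → scaleS (Fc k) (powS yS k) ⊛ L)) n
      ≡⟨ ⊛-sumSʳ m P (λ k → scaleS (Fc k) (powS yS k) ⊛ L) n ⟩
    sumTo m (λ k → (P ⊛ (scaleS (Fc k) (powS yS k) ⊛ L)) n)
      ≡⟨ Σ-ext m log-term ⟩
    sumTo m (λ k → Fc k * QL a k n) ∎
  factor-Stirling : ∀ k → Fh k * Q a k n - Fc k * QL a k n ≡ ι (rStirling r m k) * B a (factorialHyper a) (risingℚ a) k n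
  factor-Stirling k = begin
    ι (S ℕ.* k !) * hyperharmonic a k * Q a k n - ι (S ℕ.* rising a k) * QL a k n
      ≡⟨ cong₂ (λ p q → p * hyperharmonic a k * Q a k n - q * QL a k n) (ι-* S (k !)) (ι-* S (rising a k)) ⟩
    ι S * ι (k !) * hyperharmonic a k * Q a k n - ι S * ι (rising a k) * QL a k n
      ≡⟨ solve 6 (λ s f h q d l → s :* f :* h :* q :- s :* d :* l := s :* (f :* h :* q :- d :* l)) refl
           (ι S) (ι (k !)) (hyperharmonic a k) (Q a k n) (ι (rising a k)) (QL a k n) ⟩
    ι S * (ι (k !) * hyperharmonic a k * Q a k n - ι (rising a k) * QL a k n) ∎
    where
    S : ℕ
    S = rStirling r m k

term-gf : ∀ m r b → r ≤ m → term m r (suc b) ≈ (powS inv (suc b) ⊛ bracket m r (suc b))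
term-gf m r b r≤m =
  ≈-trans (term≈stirlingTransform (suc b) r m r≤m)
  (≈-trans (stirlingTransform-cong r (E≈BH b) m)
           (≈-sym (invPow⊛bracket m r (suc b))))

chainSum-product : ∀ s f n → chainSum s n f ≡ (powS inv (suc s) ⊛ f) n
chainSum-product zero f n = sym (trans (⊛-congˡ f (⊛-identityˡ inv) n) (partialSums f n))
chainSum-product (suc s) f n = begin
  sumTo n (λ k → chainSum s k f) ≡⟨ Σ-ext n (chainSum-product s f) ⟩
  sumTo n (P ⊛ f)                ≡⟨ sym (partialSums (P ⊛ f) n) ⟩
  (inv ⊛ (P ⊛ f)) n              ≡⟨ ≈-trans (≈-sym (⊛-assoc inv P f)) (⊛-congˡ f (⊛-comm inv P)) n ⟩
  ((P ⊛ inv) ⊛ f) n              ∎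
  where
  P : PS
  P = powS inv (suc s)

hockeyStick : ∀ s j → sumTo j (λ i → ι ((i ℕ.+ s) C s)) ≡ ι ((j ℕ.+ suc s) C suc s)
hockeyStick s zero = cong ι (trans (nCn≡1 s) (sym (nCn≡1 (suc s))))
hockeyStick s (suc j) = begin
  sumTo j (λ i → ι ((i ℕ.+ s) C s)) + ι (N C s)        ≡⟨ cong (_+ ι (N C s)) (hockeyStick s j) ⟩
  ι ((j ℕ.+ suc s) C suc s) + ι (N C s)                ≡⟨ sym (ι-+ ((j ℕ.+ suc s) C suc s) (N C s)) ⟩
  ι (((j ℕ.+ suc s) C suc s) ℕ.+ (N C s))              ≡⟨ cong ι pascal ⟩
  ι ((suc j ℕ.+ suc s) C suc s)                        ∎
  where
  N : ℕ
  N = suc (j ℕ.+ s)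
  pascal : ((j ℕ.+ suc s) C suc s) ℕ.+ (N C s) ≡ (suc j ℕ.+ suc s) C suc s
  pascal = begin
    ((j ℕ.+ suc s) C suc s) ℕ.+ (N C s) ≡⟨ cong (λ z → (z C suc s) ℕ.+ (N C s)) (ℕP.+-suc j s) ⟩
    (N C suc s) ℕ.+ (N C s)             ≡⟨ ℕP.+-comm (N C suc s) (N C s) ⟩
    (N C s) ℕ.+ (N C suc s)             ≡⟨ nCk+nC[k+1]≡[n+1]C[k+1] N s ⟩
    suc N C suc s                       ≡⟨ cong (λ z → suc z C suc s) (sym (ℕP.+-suc j s)) ⟩
    (suc j ℕ.+ suc s) C suc s           ∎

invPow-coeff : ∀ s j → powS inv (suc s) j ≡ ι ((j ℕ.+ s) C s)
invPow-coeff zero j = ⊛-identityˡ inv j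
invPow-coeff (suc s) j = begin
  (powS inv (suc s) ⊛ inv) j          ≡⟨ ⊛-comm (powS inv (suc s)) inv j ⟩
  (inv ⊛ powS inv (suc s)) j          ≡⟨ partialSums (powS inv (suc s)) j ⟩
  sumTo j (powS inv (suc s))          ≡⟨ Σ-ext j (invPow-coeff s) ⟩
  sumTo j (λ i → ι ((i ℕ.+ s) C s))   ≡⟨ hockeyStick s j ⟩
  ι ((j ℕ.+ suc s) C suc s)           ∎

-- Σ_{k ≤ n} C(n+s-k, s) f k  equals the chain sum of f (both are [x^n] (1-x)^{-(s+1)} f).
binomialWeighted≡chainSum : ∀ s n f → sumTo n (λ k → ι ((n ℕ.+ s ∸ k) C s) * f k) ≡ chainSum s n f
binomialWeighted≡chainSum s n f = begin
  sumTo n (λ k → ι ((n ℕ.+ s ∸ k) C s) * f k)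
    ≡⟨ Σ-cong n weight ⟩
  (f ⊛ powS inv (suc s)) n
    ≡⟨ ⊛-comm f (powS inv (suc s)) n ⟩
  (powS inv (suc s) ⊛ f) n
    ≡⟨ sym (chainSum-product s f n) ⟩
  chainSum s n f ∎
  where
  weight : ∀ k → k ≤ n → ι ((n ℕ.+ s ∸ k) C s) * f k ≡ f k * powS inv (suc s) (n ∸ k)
  weight k k≤n = trans (cong (λ z → ι (z C s) * f k) (ℕP.+-∸-comm s k≤n))
                       (trans (cong (_* f k) (sym (invPow-coeff s (n ∸ k)))) (ℚP.*-comm _ (f k)))

-- The second series is the Cauchy product of (1-x)^{-(s+1)} with the
-- summand: below r both vanish, since the summand does.
midS-product : ∀ m r s a n → midS m r s a n ≡ (powS inv (suc s) ⊛ term m r a) n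
midS-product m r s a n with n ℕP.<? r
... | yes n<r = begin
  midS m r s a n
    ≡⟨ cong (λ t → if t then 0ℚ else chainSum s n (term m r a)) (dec-true (n ℕP.<? r) n<r) ⟩
  0ℚ
    ≡⟨ sym (Σ-vanish n _ (λ i i≤n → trans (cong (P i *_) (term-belowR m r a (n ∸ i) (ℕP.≤-<-trans (ℕP.m∸n≤m n i) n<r)))
                                            (ℚP.*-zeroʳ (P i)))) ⟩
  (P ⊛ term m r a) n ∎
  where
  P : PS
  P = powS inv (suc s)
... | no n≮r = begin
  midS m r s a n
    ≡⟨ cong (λ t → if t then 0ℚ else chainSum s n (term m r a)) (dec-false (n ℕP.<? r) n≮r) ⟩
  chainSum s n (term m r a)
    ≡⟨ chainSum-product s (term m r a) n ⟩
  (powS inv (suc s) ⊛ term m r a) n ∎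

rhsS-product : ∀ m r s a → rhsS m r s a ≈ (powS inv (suc s) ⊛ (powS inv a ⊛ bracket m r a))
rhsS-product m r s a =
  ≈-trans (⊛-congˡ (bracket m r a) (λ n → cong (λ e → powS inv e n) exponent))
  (≈-trans (⊛-congˡ (bracket m r a) (powS-+ inv a (suc s)))
           (⊛-assoc (powS inv (suc s)) (powS inv a) (bracket m r a)))
  where
  exponent : a ℕ.+ s ℕ.+ 1 ≡ a ℕ.+ suc s
  exponent = trans (ℕP.+-comm (a ℕ.+ s) 1) (sym (ℕP.+-suc a s))

mainTheorem15 : (m r s α : ℕ) → r ≤ m → 1 ≤ α →
    ((n : ℕ) → lhsS m r s α n ≡ midS m r s α n) ×
    ((n : ℕ) → midS m r s α n ≡ rhsS m r s α n)
mainTheorem15 m r s (suc b) r≤m (s≤s z≤n) = lhs≡mid , mid≡rhs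
  where
  lhs≡mid : ∀ n → lhsS m r s (suc b) n ≡ midS m r s (suc b) n
  lhs≡mid n = cong (if n <ᵇ r then 0ℚ else_) (binomialWeighted≡chainSum s n (term m r (suc b)))
  mid≡rhs : ∀ n → midS m r s (suc b) n ≡ rhsS m r s (suc b) n
  mid≡rhs n = begin
    midS m r s (suc b) n
      ≡⟨ midS-product m r s (suc b) n ⟩
    (powS inv (suc s) ⊛ term m r (suc b)) n
      ≡⟨ ⊛-congʳ (powS inv (suc s)) (term-gf m r b r≤m) n ⟩
    (powS inv (suc s) ⊛ (powS inv (suc b) ⊛ bracket m r (suc b))) n
      ≡⟨ sym (rhsS-product m r s (suc b) n) ⟩
    rhsS m r s (suc b) n ∎
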